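{- For all $n\ge 4$, $\rho(AQ_n)=3$.
   Context: The augmented hypercube $AQ_n$ has vertex set $\mathbb{Z}_2^n$; two vertices are adjacent iff either they differ in exactly one position, or for some $0\le \ell\le n-2$ they agree in the first $\ell$ positions and differ in all of the remaining $n-\ell$ positions. For $n\ge4$, $AQ_n$ has a distinguishing coloring with 2 colors (a coloring for which the only automorphism preserving each color class is the identity). For such a graph $G$, the cost $\rho(G)$ is the minimum size of a color class over all distinguishing 2-colorings of $G$. -}

module Defs where

open import Data.Nat using (ℕ; zero; suc; _≤_; _<_; _∸_)
open import Data.Fin using (Fin; toℕ)
open import Data.Bool using (Bool; true; false)
open import Data.Bool.Properties using () renaming (_≟_ to _≟ᵇ_)
open import Data.Vec using (Vec; []; _∷_; lookup)
open import Data.List using (List; []; _∷_; map; _++_; filter; length)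
open import Data.Product using (Σ; ∃; _×_)
open import Data.Sum using (_⊎_)
open import Relation.Binary.PropositionalEquality using (_≡_; _≢_)
open import Function.Bundles using (_↔_; Inverse)

Vertex : ℕ → Set
Vertex n = Vec Bool n

allVertices : (n : ℕ) → List (Vertex n)
allVertices zero = [] ∷ []
allVertices (suc n) = map (true ∷_) (allVertices n) ++ map (false ∷_) (allVertices n)

Adj : (n : ℕ) → Vertex n → Vertex n → Set
Adj n u v =
  (Σ (Fin n) λ i → (lookup u i ≢ lookup v i) ×
                   ((j : Fin n) → j ≢ i → lookup u j ≡ lookup v j))
  ⊎
  (Σ ℕ λ ℓ → (ℓ ≤ n ∸ 2) ×
     (((i : Fin n) → toℕ i < ℓ → lookup u i ≡ lookup v i) ×
      ((i : Fin n) → ℓ ≤ toℕ i → lookup u i ≢ lookup v i)))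

record Automorphism (n : ℕ) : Set where
  field
    perm : Vertex n ↔ Vertex n
    preservesAdj : (u v : Vertex n) →
      (Adj n u v → Adj n (Inverse.to perm u) (Inverse.to perm v)) ×
      (Adj n (Inverse.to perm u) (Inverse.to perm v) → Adj n u v)

Coloring : ℕ → Set
Coloring n = Vertex n → Bool

Distinguishing : (n : ℕ) → Coloring n → Set
Distinguishing n c = (σ : Automorphism n) →
  ((v : Vertex n) → c (Inverse.to (Automorphism.perm σ) v) ≡ c v) →
  (v : Vertex n) → Inverse.to (Automorphism.perm σ) v ≡ v

classSize : (n : ℕ) → Coloring n → Bool → ℕ
classSize n c b = length (filter (λ v → c v ≟ᵇ b) (allVertices n))

CostIs : (n : ℕ) → ℕ → Set
CostIs n k =
  (Σ (Coloring n) λ c → Distinguishing n c × (Σ Bool λ b → classSize n c b ≡ k))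
  × ((c : Coloring n) → Distinguishing n c → (b : Bool) → k ≤ classSize n c b)

-- AQₙ is a Cayley graph of ℤ₂ⁿ, so translations are automorphisms, as is the map
-- complementing the last n - 1 coordinates of the vectors starting with 1; every colour class
-- with at most two vertices is preserved by a non-identity automorphism built from these.
-- Conversely, in the neighbourhood of 0 the generators form a chain-like subgraph, which
-- forces an automorphism fixing 0, e₀ and eₙ₋₁ to fix the whole neighbourhood; conjugating
-- with translations spreads this to all vertices.  The colour class {0, eₙ₋₁, e₀ ⊕ e₂} pins
-- down 0, e₀ and eₙ₋₁.
module Submission where

open import Defs
open import Data.Bool using (Bool; true; false; _xor_; _∧_; _∨_)
open import Data.Bool.Properties
  using (xor-comm; xor-assoc; xor-identityˡ; xor-identityʳ; xor-same; xor-inverseˡ; ¬-not)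
  renaming (_≟_ to _≟ᵇ_)
open import Data.Empty using (⊥; ⊥-elim)
open import Data.Fin using (Fin; toℕ) renaming (zero to fzero; suc to fsuc)
open import Data.Fin.Properties using (toℕ<n) renaming (suc-injective to fsuc-injective)
open import Data.List using (List; []; _∷_; _++_; map; filter; length)
open import Data.List.Membership.Propositional using (_∈_)
open import Data.List.Membership.Propositional.Properties
  using (∈-map⁺; ∈-++⁺ˡ; ∈-++⁺ʳ; ∈-filter⁺; ∈-filter⁻)
open import Data.List.Properties using (filter-++; length-++)
open import Data.List.Relation.Unary.All using ([]; _∷_)
open import Data.List.Relation.Unary.All.Properties using (All¬⇒¬Any)
open import Data.List.Relation.Unary.Any using (here; there; any?)
open import Data.List.Relation.Unary.Unique.Propositional using (Unique; []; _∷_)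
open import Data.Nat using (ℕ; zero; suc; _≤_; _<_; _∸_; _+_; z≤n; s≤s)
open import Data.Nat.Properties
  using (≤-trans; m∸n≤m; n≤1+n; n<1+n; m≤n⇒m≤1+n; <⇒≢; <⇒≤; +-suc; m≤n+m; m∸n+n≡m)
open import Data.Product using (Σ; _×_; _,_; proj₁; proj₂)
open import Data.Sum using (_⊎_; inj₁; inj₂; [_,_]′)
open import Data.Vec using ([]; _∷_; lookup; zipWith; replicate; head; tail)
open import Data.Vec.Properties
  using (zipWith-comm; zipWith-assoc; zipWith-identityˡ; zipWith-identityʳ; ≡-dec)
open import Function.Base using (_∘_; id; case_of_)
open import Function.Bundles using (Inverse; Injection; mk↔ₛ′)
open import Function.Properties.Inverse using (Inverse⇒Injection)
open import Relation.Binary.Definitions using (DecidableEquality)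
open import Relation.Binary.PropositionalEquality
open import Relation.Nullary using (¬_; does; yes; no)
open import Relation.Nullary.Decidable using (dec-true; dec-false)

infixl 6 _⊕_

_⊕_ : ∀ {n} → Vertex n → Vertex n → Vertex n
_⊕_ = zipWith _xor_

zeros ones : (n : ℕ) → Vertex n
zeros n = replicate n false
ones n = replicate n true

⊕-comm : ∀ {n} (u v : Vertex n) → u ⊕ v ≡ v ⊕ u
⊕-comm = zipWith-comm xor-comm

⊕-assoc : ∀ {n} (u v w : Vertex n) → (u ⊕ v) ⊕ w ≡ u ⊕ (v ⊕ w)
⊕-assoc = zipWith-assoc xor-assoc

⊕-identityˡ : ∀ {n} (v : Vertex n) → zeros n ⊕ v ≡ v
⊕-identityˡ = zipWith-identityˡ xor-identityˡ

⊕-identityʳ : ∀ {n} (v : Vertex n) → v ⊕ zeros n ≡ v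
⊕-identityʳ = zipWith-identityʳ xor-identityʳ

⊕-self : ∀ {n} (v : Vertex n) → v ⊕ v ≡ zeros n
⊕-self [] = refl
⊕-self (b ∷ v) = cong₂ _∷_ (xor-same b) (⊕-self v)

⊕-cancelʳ : ∀ {n} (u v : Vertex n) → (u ⊕ v) ⊕ v ≡ u
⊕-cancelʳ {n} u v = begin
  (u ⊕ v) ⊕ v  ≡⟨ ⊕-assoc u v v ⟩
  u ⊕ (v ⊕ v)  ≡⟨ cong (u ⊕_) (⊕-self v) ⟩
  u ⊕ zeros n  ≡⟨ ⊕-identityʳ u ⟩
  u            ∎
  where open ≡-Reasoning

⊕-cancelˡ : ∀ {n} (u v : Vertex n) → u ⊕ (u ⊕ v) ≡ v
⊕-cancelˡ u v = trans (sym (⊕-assoc u u v)) (trans (cong (_⊕ v) (⊕-self u)) (⊕-identityˡ v))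

⊕-shiftʳ : ∀ {n} (u v x : Vertex n) → (u ⊕ x) ⊕ (v ⊕ x) ≡ u ⊕ v
⊕-shiftʳ u v x = begin
  (u ⊕ x) ⊕ (v ⊕ x)  ≡⟨ ⊕-assoc u x (v ⊕ x) ⟩
  u ⊕ (x ⊕ (v ⊕ x))  ≡⟨ cong (λ y → u ⊕ (x ⊕ y)) (⊕-comm v x) ⟩
  u ⊕ (x ⊕ (x ⊕ v))  ≡⟨ cong (u ⊕_) (⊕-cancelˡ x v) ⟩
  u ⊕ v              ∎
  where open ≡-Reasoning

⊕-injectiveʳ : ∀ {n} {u v : Vertex n} (x : Vertex n) → u ⊕ x ≡ v ⊕ x → u ≡ v
⊕-injectiveʳ {u = u} {v} x e = trans (sym (⊕-cancelʳ u x)) (trans (cong (_⊕ x) e) (⊕-cancelʳ v x))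

⊕≡⇒≡⊕ : ∀ {n} {u v w : Vertex n} → u ⊕ v ≡ w → u ≡ w ⊕ v
⊕≡⇒≡⊕ {u = u} {v} e = trans (sym (⊕-cancelʳ u v)) (cong (_⊕ v) e)

Constant : ∀ {n} → Vertex n → Set
Constant {n} v = v ≡ zeros n ⊎ v ≡ ones n

-- AQₙ is the Cayley graph of (ℤ₂ⁿ, ⊕) whose connection set consists of the unit
-- vectors and the vectors 0ᵈ1ⁿ⁻ᵈ with d ≤ n - 2: after its leading zeros a
-- generator has a 1 followed by only zeros or only ones.
Gen : ∀ {n} → Vertex n → Set
Gen [] = ⊥
Gen (false ∷ v) = Gen v
Gen (true ∷ v) = Constant v

-- oneHot n k = eₖ and onesFrom n d = 0ᵈ1ⁿ⁻ᵈ; both are zeros n when the index is ≥ n.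
oneHot : (n : ℕ) → ℕ → Vertex n
oneHot zero _ = []
oneHot (suc n) zero = true ∷ zeros n
oneHot (suc n) (suc k) = false ∷ oneHot n k

onesFrom : (n : ℕ) → ℕ → Vertex n
onesFrom zero _ = []
onesFrom (suc n) zero = ones (suc n)
onesFrom (suc n) (suc d) = false ∷ onesFrom n d

onesFrom-zero : ∀ n → onesFrom n 0 ≡ ones n
onesFrom-zero zero = refl
onesFrom-zero (suc n) = refl

Gen-oneHot : ∀ n k → k < n → Gen (oneHot n k)
Gen-oneHot (suc n) zero _ = inj₁ refl
Gen-oneHot (suc n) (suc k) (s≤s k<n) = Gen-oneHot n k k<n

Gen-onesFrom : ∀ n d → d < n → Gen (onesFrom n d)
Gen-onesFrom (suc n) zero _ = inj₂ refl
Gen-onesFrom (suc n) (suc d) (s≤s d<n) = Gen-onesFrom n d d<n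

Gen-classify : ∀ {n} (c : Vertex n) → Gen c →
               (Σ ℕ λ k → k < n × c ≡ oneHot n k) ⊎ (Σ ℕ λ d → 2 + d ≤ n × c ≡ onesFrom n d)
Gen-classify (false ∷ c) g with Gen-classify c g
... | inj₁ (k , k<n , refl) = inj₁ (suc k , s≤s k<n , refl)
... | inj₂ (d , 2+d≤n , refl) = inj₂ (suc d , s≤s 2+d≤n , refl)
Gen-classify (true ∷ c) (inj₁ refl) = inj₁ (0 , s≤s z≤n , refl)
Gen-classify (true ∷ []) (inj₂ refl) = inj₁ (0 , s≤s z≤n , refl)
Gen-classify (true ∷ _ ∷ c) (inj₂ refl) = inj₂ (0 , s≤s (s≤s z≤n) , refl)

xor≡false⇒≡ : ∀ {a b} → a xor b ≡ false → a ≡ b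
xor≡false⇒≡ {false} {false} _ = refl
xor≡false⇒≡ {true} {true} _ = refl

xor≡true⇒≢ : ∀ {a b} → a xor b ≡ true → a ≢ b
xor≡true⇒≢ {a} e refl with () ← trans (sym (xor-same a)) e

≢⇒xor≡true : ∀ {a b} → a ≢ b → a xor b ≡ true
≢⇒xor≡true {b = b} a≢b rewrite ¬-not a≢b = xor-inverseˡ b

⊕≡zeros⇒≡ : ∀ {n} {u v : Vertex n} → u ⊕ v ≡ zeros n → u ≡ v
⊕≡zeros⇒≡ {v = v} e = trans (⊕≡⇒≡⊕ e) (⊕-identityˡ v)

⊕≡ones⇒≢ : ∀ {n} (u v : Vertex n) → u ⊕ v ≡ ones n → ∀ i → lookup u i ≢ lookup v i
⊕≡ones⇒≢ (a ∷ u) (b ∷ v) e fzero = xor≡true⇒≢ (cong head e)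
⊕≡ones⇒≢ (a ∷ u) (b ∷ v) e (fsuc i) = ⊕≡ones⇒≢ u v (cong tail e) i

⊕≡oneHot⇒differAt : ∀ {n} (u v : Vertex n) k → k < n → u ⊕ v ≡ oneHot n k →
  Σ (Fin n) λ i → (lookup u i ≢ lookup v i) × ((j : Fin n) → j ≢ i → lookup u j ≡ lookup v j)
⊕≡oneHot⇒differAt (a ∷ u) (b ∷ v) zero _ e = fzero , xor≡true⇒≢ (cong head e) , agree
  where
  agree : ∀ j → j ≢ fzero → lookup (a ∷ u) j ≡ lookup (b ∷ v) j
  agree fzero j≢0 = ⊥-elim (j≢0 refl)
  agree (fsuc j) _ = cong (λ w → lookup w j) (⊕≡zeros⇒≡ (cong tail e))
⊕≡oneHot⇒differAt (a ∷ u) (b ∷ v) (suc k) (s≤s k<n) e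
  with i , u≢v , agree ← ⊕≡oneHot⇒differAt u v k k<n (cong tail e) = fsuc i , u≢v , agree′
  where
  agree′ : ∀ j → j ≢ fsuc i → lookup (a ∷ u) j ≡ lookup (b ∷ v) j
  agree′ fzero _ = xor≡false⇒≡ (cong head e)
  agree′ (fsuc j) j≢i = agree j (λ j≡i → j≢i (cong fsuc j≡i))

⊕≡onesFrom⇒agree-differ : ∀ {n} (u v : Vertex n) d → u ⊕ v ≡ onesFrom n d →
  ((i : Fin n) → toℕ i < d → lookup u i ≡ lookup v i) ×
  ((i : Fin n) → d ≤ toℕ i → lookup u i ≢ lookup v i)
⊕≡onesFrom⇒agree-differ {n} u v zero e =
  (λ _ ()) , (λ i _ → ⊕≡ones⇒≢ u v (trans e (onesFrom-zero n)) i)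
⊕≡onesFrom⇒agree-differ [] [] (suc d) _ = (λ ()) , (λ ())
⊕≡onesFrom⇒agree-differ (a ∷ u) (b ∷ v) (suc d) e
  with agree , differ ← ⊕≡onesFrom⇒agree-differ u v d (cong tail e) = agree′ , differ′
  where
  agree′ : ∀ i → toℕ i < suc d → lookup (a ∷ u) i ≡ lookup (b ∷ v) i
  agree′ fzero _ = xor≡false⇒≡ (cong head e)
  agree′ (fsuc i) (s≤s i<d) = agree i i<d
  differ′ : ∀ i → suc d ≤ toℕ i → lookup (a ∷ u) i ≢ lookup (b ∷ v) i
  differ′ (fsuc i) (s≤s d≤i) = differ i d≤i

agree⇒⊕≡zeros : ∀ {n} (u v : Vertex n) → (∀ i → lookup u i ≡ lookup v i) → u ⊕ v ≡ zeros n
agree⇒⊕≡zeros [] [] _ = refl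
agree⇒⊕≡zeros (a ∷ u) (b ∷ v) agree =
  cong₂ _∷_ (trans (cong (a xor_) (sym (agree fzero))) (xor-same a))
            (agree⇒⊕≡zeros u v (λ i → agree (fsuc i)))

differ⇒⊕≡ones : ∀ {n} (u v : Vertex n) → (∀ i → lookup u i ≢ lookup v i) → u ⊕ v ≡ ones n
differ⇒⊕≡ones [] [] _ = refl
differ⇒⊕≡ones (a ∷ u) (b ∷ v) differ =
  cong₂ _∷_ (≢⇒xor≡true (differ fzero)) (differ⇒⊕≡ones u v (λ i → differ (fsuc i)))

differAt⇒⊕≡oneHot : ∀ {n} (u v : Vertex n) (i : Fin n) → lookup u i ≢ lookup v i →
                    ((j : Fin n) → j ≢ i → lookup u j ≡ lookup v j) → u ⊕ v ≡ oneHot n (toℕ i)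
differAt⇒⊕≡oneHot (a ∷ u) (b ∷ v) fzero a≢b agree =
  cong₂ _∷_ (≢⇒xor≡true a≢b) (agree⇒⊕≡zeros u v (λ j → agree (fsuc j) (λ ())))
differAt⇒⊕≡oneHot (a ∷ u) (b ∷ v) (fsuc i) u≢v agree =
  cong₂ _∷_ (trans (cong (a xor_) (sym (agree fzero (λ ())))) (xor-same a))
            (differAt⇒⊕≡oneHot u v i u≢v (λ j j≢i → agree (fsuc j) (λ e → j≢i (fsuc-injective e))))

agree-differ⇒⊕≡onesFrom : ∀ {n} (u v : Vertex n) ℓ →
  ((i : Fin n) → toℕ i < ℓ → lookup u i ≡ lookup v i) →
  ((i : Fin n) → ℓ ≤ toℕ i → lookup u i ≢ lookup v i) → u ⊕ v ≡ onesFrom n ℓ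
agree-differ⇒⊕≡onesFrom {n} u v zero _ differ =
  trans (differ⇒⊕≡ones u v (λ i → differ i z≤n)) (sym (onesFrom-zero n))
agree-differ⇒⊕≡onesFrom [] [] (suc ℓ) _ _ = refl
agree-differ⇒⊕≡onesFrom (a ∷ u) (b ∷ v) (suc ℓ) agree differ =
  cong₂ _∷_ (trans (cong (a xor_) (sym (agree fzero (s≤s z≤n)))) (xor-same a))
            (agree-differ⇒⊕≡onesFrom u v ℓ (λ i i<ℓ → agree (fsuc i) (s≤s i<ℓ))
                                           (λ i ℓ≤i → differ (fsuc i) (s≤s ℓ≤i)))

-- In AQ₀ the empty vertex is adjacent to itself (ℓ = 0 ≤ 0 ∸ 2), hence the positive dimension.
Adj⇒Gen : ∀ {m} (u v : Vertex (suc m)) → Adj (suc m) u v → Gen (u ⊕ v)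
Adj⇒Gen {m} u v (inj₁ (i , u≢v , agree)) =
  subst Gen (sym (differAt⇒⊕≡oneHot u v i u≢v agree)) (Gen-oneHot (suc m) (toℕ i) (toℕ<n i))
Adj⇒Gen {m} u v (inj₂ (ℓ , ℓ≤ , agree , differ)) =
  subst Gen (sym (agree-differ⇒⊕≡onesFrom u v ℓ agree differ))
            (Gen-onesFrom (suc m) ℓ (s≤s (≤-trans ℓ≤ (m∸n≤m m 1))))

Gen⇒Adj : ∀ {n} (u v : Vertex n) → Gen (u ⊕ v) → Adj n u v
Gen⇒Adj {n} u v g with Gen-classify (u ⊕ v) g
... | inj₁ (k , k<n , e) = inj₁ (⊕≡oneHot⇒differAt u v k k<n e)
... | inj₂ (d , s≤s (s≤s d≤n∸2) , e) = inj₂ (d , d≤n∸2 , ⊕≡onesFrom⇒agree-differ u v d e)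

record IsEmbedding {n} (f : Vertex n → Vertex n) : Set where
  field
    injective : ∀ {u v} → f u ≡ f v → u ≡ v
    preserves : ∀ {u v} → Gen (u ⊕ v) → Gen (f u ⊕ f v)
    reflects : ∀ {u v} → Gen (f u ⊕ f v) → Gen (u ⊕ v)

open IsEmbedding

automorphism⇒embedding : ∀ {m} (σ : Automorphism (suc m)) →
                         IsEmbedding (Inverse.to (Automorphism.perm σ))
automorphism⇒embedding σ = record
  { injective = Injection.injective (Inverse⇒Injection perm)
  ; preserves = λ {u} {v} g → Adj⇒Gen (f u) (f v) (proj₁ (preservesAdj u v) (Gen⇒Adj u v g))
  ; reflects = λ {u} {v} g → Adj⇒Gen u v (proj₂ (preservesAdj u v) (Gen⇒Adj (f u) (f v) g))
  }
  where
  open Automorphism σ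
  f : Vertex (suc _) → Vertex (suc _)
  f = Inverse.to perm

Gen-preserved : ∀ {n} {f : Vertex n → Vertex n} → IsEmbedding f → f (zeros n) ≡ zeros n →
                ∀ {c} → Gen c → Gen (f c)
Gen-preserved {n} {f} emb f0 {c} g =
  subst Gen (trans (cong (_⊕ f c) f0) (⊕-identityˡ (f c)))
            (preserves emb (subst Gen (sym (⊕-identityˡ c)) g))

conjugate : ∀ {n} → (Vertex n → Vertex n) → Vertex n → Vertex n → Vertex n
conjugate f x v = f (v ⊕ x) ⊕ x

∘-embedding : ∀ {n} {f g : Vertex n → Vertex n} →
              IsEmbedding f → IsEmbedding g → IsEmbedding (f ∘ g)
∘-embedding f-emb g-emb = record
  { injective = injective g-emb ∘ injective f-emb
  ; preserves = preserves f-emb ∘ preserves g-emb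
  ; reflects = reflects g-emb ∘ reflects f-emb
  }

translation-embedding : ∀ {n} (x : Vertex n) → IsEmbedding (_⊕ x)
translation-embedding x = record
  { injective = ⊕-injectiveʳ x
  ; preserves = λ {u} {v} → subst Gen (sym (⊕-shiftʳ u v x))
  ; reflects = λ {u} {v} → subst Gen (⊕-shiftʳ u v x)
  }

conjugate-embedding : ∀ {n} {f : Vertex n → Vertex n} → IsEmbedding f → ∀ x →
                      IsEmbedding (conjugate f x)
conjugate-embedding emb x =
  ∘-embedding (translation-embedding x) (∘-embedding emb (translation-embedding x))

conjugate-fixes : ∀ {n} (f : Vertex n → Vertex n) x v → f (v ⊕ x) ≡ v ⊕ x → conjugate f x v ≡ v
conjugate-fixes f x v e = trans (cong (_⊕ x) e) (⊕-cancelʳ v x)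

fixes-of-conjugate : ∀ {n} (f : Vertex n → Vertex n) x v → conjugate f x v ≡ v → f (v ⊕ x) ≡ v ⊕ x
fixes-of-conjugate f x v e = ⊕≡⇒≡⊕ e

Constant-⊕ : ∀ {n} {a s : Vertex n} → Constant a → Constant (a ⊕ s) → Constant s
Constant-⊕ {n} {a} {s} a-const as-const = subst Constant (⊕-cancelˡ a s) (sum a-const as-const)
  where
  sum : ∀ {x y : Vertex n} → Constant x → Constant y → Constant (x ⊕ y)
  sum (inj₁ refl) (inj₁ refl) = inj₁ (⊕-self (zeros n))
  sum (inj₁ refl) (inj₂ refl) = inj₂ (⊕-identityˡ (ones n))
  sum (inj₂ refl) (inj₁ refl) = inj₂ (⊕-identityʳ (ones n))
  sum (inj₂ refl) (inj₂ refl) = inj₁ (⊕-self (ones n))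

¬Gen-zeros : ∀ n → ¬ Gen (zeros n)
¬Gen-zeros (suc n) g = ¬Gen-zeros n g

oneHot≢zeros : ∀ n k → k < n → oneHot n k ≢ zeros n
oneHot≢zeros n k k<n e = ¬Gen-zeros n (subst Gen e (Gen-oneHot n k k<n))

onesFrom≢zeros : ∀ n d → d < n → onesFrom n d ≢ zeros n
onesFrom≢zeros n d d<n e = ¬Gen-zeros n (subst Gen e (Gen-onesFrom n d d<n))

oneHot≢ones : ∀ n k → 2 ≤ n → oneHot n k ≢ ones n
oneHot≢ones (suc (suc n)) zero _ ()
oneHot≢ones (suc zero) zero (s≤s ()) _
oneHot≢ones (suc n) (suc k) _ ()

onesFrom≢ones : ∀ n d → suc d < n → onesFrom n (suc d) ≢ ones n
onesFrom≢ones (suc n) d _ ()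

oneHot≢onesFrom : ∀ n d → 2 + d ≤ n → oneHot n d ≢ onesFrom n d
oneHot≢onesFrom (suc (suc n)) zero _ ()
oneHot≢onesFrom (suc n) (suc d) (s≤s 2+d≤n) e = oneHot≢onesFrom n d 2+d≤n (cong tail e)

leadingZeros : ∀ {n} → Vertex n → ℕ
leadingZeros [] = 0
leadingZeros (true ∷ _) = 0
leadingZeros (false ∷ v) = suc (leadingZeros v)

leadingZeros-oneHot : ∀ n k → k < n → leadingZeros (oneHot n k) ≡ k
leadingZeros-oneHot (suc n) zero _ = refl
leadingZeros-oneHot (suc n) (suc k) (s≤s k<n) = cong suc (leadingZeros-oneHot n k k<n)

leadingZeros-onesFrom : ∀ n d → d ≤ n → leadingZeros (onesFrom n d) ≡ d
leadingZeros-onesFrom zero zero _ = refl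
leadingZeros-onesFrom (suc n) zero _ = refl
leadingZeros-onesFrom (suc n) (suc d) (s≤s d≤n) = cong suc (leadingZeros-onesFrom n d d≤n)

≢-by-leadingZeros : ∀ {n} {u v : Vertex n} {i j} →
                    leadingZeros u ≡ i → leadingZeros v ≡ j → i ≢ j → u ≢ v
≢-by-leadingZeros refl refl i≢j u≡v = i≢j (cong leadingZeros u≡v)

neighbours-ones : ∀ {n} (c : Vertex n) → Gen c → Gen (c ⊕ ones n) →
                  c ∈ onesFrom n 1 ∷ oneHot n 0 ∷ []
neighbours-ones {suc n} (false ∷ c) _ (inj₁ e) =
  here (cong (false ∷_) (trans (trans (⊕≡⇒≡⊕ e) (⊕-identityˡ (ones n))) (sym (onesFrom-zero n))))
neighbours-ones {suc n} (false ∷ c) g (inj₂ e) =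
  ⊥-elim (¬Gen-zeros n (subst Gen (trans (⊕≡⇒≡⊕ e) (⊕-self (ones n))) g))
neighbours-ones (true ∷ c) (inj₁ refl) _ = there (here refl)
neighbours-ones {suc n} (true ∷ c) (inj₂ refl) g = ⊥-elim (¬Gen-zeros n (subst Gen (⊕-self (ones n)) g))

neighbours-oneHot : ∀ n j → 2 + j ≤ n → (c : Vertex n) → Gen c → Gen (c ⊕ oneHot n j) →
                    c ∈ onesFrom n j ∷ onesFrom n (suc j) ∷ []
neighbours-oneHot (suc n) zero _ (false ∷ c) g (inj₁ e) =
  ⊥-elim (¬Gen-zeros n (subst Gen (trans (⊕≡⇒≡⊕ e) (⊕-self (zeros n))) g))
neighbours-oneHot (suc n) zero _ (false ∷ c) _ (inj₂ e) =
  there (here (cong (false ∷_) (trans (trans (⊕≡⇒≡⊕ e) (⊕-identityʳ (ones n))) (sym (onesFrom-zero n)))))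
neighbours-oneHot (suc n) zero _ (true ∷ c) (inj₁ refl) g =
  ⊥-elim (¬Gen-zeros n (subst Gen (⊕-self (zeros n)) g))
neighbours-oneHot (suc n) zero _ (true ∷ c) (inj₂ refl) _ = here refl
neighbours-oneHot (suc n) (suc j) (s≤s 2+j≤n) (false ∷ c) g g′ =
  ∈-map⁺ (false ∷_) (neighbours-oneHot n j 2+j≤n c g g′)
neighbours-oneHot (suc n) (suc j) (s≤s 2+j≤n) (true ∷ c) g g′ with Constant-⊕ g g′
... | inj₁ e = ⊥-elim (oneHot≢zeros n j (≤-trans (n≤1+n _) 2+j≤n) e)
... | inj₂ e = ⊥-elim (oneHot≢ones n j (≤-trans (s≤s (s≤s z≤n)) 2+j≤n) e)

neighbours-onesFrom : ∀ n d → suc d < n → (c : Vertex n) → Gen c → Gen (c ⊕ onesFrom n (suc d)) →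
  c ∈ onesFrom n d ∷ oneHot n d ∷ onesFrom n (2 + d) ∷ oneHot n (suc d) ∷ []
neighbours-onesFrom (suc n) zero _ (false ∷ c) g g′ =
  there (there (∈-map⁺ (false ∷_) (neighbours-ones c g (subst (λ v → Gen (c ⊕ v)) (onesFrom-zero n) g′))))
neighbours-onesFrom (suc n) zero _ (true ∷ c) (inj₁ refl) _ = there (here refl)
neighbours-onesFrom (suc n) zero _ (true ∷ c) (inj₂ refl) _ = here refl
neighbours-onesFrom (suc n) (suc d) (s≤s d+1<n) (false ∷ c) g g′ =
  ∈-map⁺ (false ∷_) (neighbours-onesFrom n d d+1<n c g g′)
neighbours-onesFrom (suc n) (suc d) (s≤s d+1<n) (true ∷ c) g g′ with Constant-⊕ g g′
... | inj₁ e = ⊥-elim (onesFrom≢zeros n (suc d) d+1<n e)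
... | inj₂ e = ⊥-elim (onesFrom≢ones n d d+1<n e)

onesFrom-step : ∀ n d → d < n → onesFrom n d ⊕ onesFrom n (suc d) ≡ oneHot n d
onesFrom-step (suc n) zero _ =
  cong (true ∷_) (trans (cong (ones n ⊕_) (onesFrom-zero n)) (⊕-self (ones n)))
onesFrom-step (suc n) (suc d) (s≤s d<n) = cong (false ∷_) (onesFrom-step n d d<n)

Gen-onesFrom⊕onesFrom : ∀ n d → d < n → Gen (onesFrom n d ⊕ onesFrom n (suc d))
Gen-onesFrom⊕onesFrom n d d<n = subst Gen (sym (onesFrom-step n d d<n)) (Gen-oneHot n d d<n)

Gen-oneHot⊕onesFrom : ∀ n d → d < n → Gen (oneHot n d ⊕ onesFrom n (suc d))
Gen-oneHot⊕onesFrom n d d<n =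
  subst Gen (sym (trans (cong (_⊕ onesFrom n (suc d)) (sym (onesFrom-step n d d<n)))
                        (⊕-cancelʳ (onesFrom n d) (onesFrom n (suc d)))))
            (Gen-onesFrom n d d<n)

onesFrom-last : ∀ n → onesFrom (suc n) n ≡ oneHot (suc n) n
onesFrom-last zero = refl
onesFrom-last (suc n) = cong (false ∷_) (onesFrom-last n)

onesFrom-beyond : ∀ n → onesFrom n n ≡ zeros n
onesFrom-beyond zero = refl
onesFrom-beyond (suc n) = cong (false ∷_) (onesFrom-beyond n)

oneHot-beyond : ∀ n → oneHot n n ≡ zeros n
oneHot-beyond zero = refl
oneHot-beyond (suc n) = cong (false ∷_) (oneHot-beyond n)

n≢2+n : ∀ n → n ≢ 2 + n
n≢2+n n = <⇒≢ (m≤n⇒m≤1+n (n<1+n n))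

record ThreeLocalNeighbours {n} (x : Vertex n) : Set where
  field
    {a b c} : Vertex n
    generators : Gen a × Gen b × Gen c
    adjacent : Gen (a ⊕ x) × Gen (b ⊕ x) × Gen (c ⊕ x)
    distinct : a ≢ b × a ≢ c × b ≢ c

ThreeLocalNeighbours-preserved : ∀ {n} {f : Vertex n → Vertex n} → IsEmbedding f →
  f (zeros n) ≡ zeros n → ∀ {x} → ThreeLocalNeighbours x → ThreeLocalNeighbours (f x)
ThreeLocalNeighbours-preserved emb f0 record
  { generators = ga , gb , gc ; adjacent = ax , bx , cx ; distinct = a≢b , a≢c , b≢c } = record
  { generators = Gen-preserved emb f0 ga , Gen-preserved emb f0 gb , Gen-preserved emb f0 gc
  ; adjacent = preserves emb ax , preserves emb bx , preserves emb cx
  ; distinct = a≢b ∘ injective emb , a≢c ∘ injective emb , b≢c ∘ injective emb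
  }

pigeonhole : ∀ {A : Set} {a b c p q : A} → a ∈ p ∷ q ∷ [] → b ∈ p ∷ q ∷ [] → c ∈ p ∷ q ∷ [] →
             a ≢ b → a ≢ c → b ≢ c → ⊥
pigeonhole (here refl) (here refl) _ a≢b _ _ = a≢b refl
pigeonhole (there (here refl)) (there (here refl)) _ a≢b _ _ = a≢b refl
pigeonhole (here refl) (there (here refl)) (here refl) _ a≢c _ = a≢c refl
pigeonhole (here refl) (there (here refl)) (there (here refl)) _ _ b≢c = b≢c refl
pigeonhole (there (here refl)) (here refl) (here refl) _ _ b≢c = b≢c refl
pigeonhole (there (here refl)) (here refl) (there (here refl)) _ a≢c _ = a≢c refl

¬ThreeLocalNeighbours-oneHot : ∀ n j → 2 + j ≤ n → ¬ ThreeLocalNeighbours (oneHot n j)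
¬ThreeLocalNeighbours-oneHot n j 2+j≤n record
  { generators = ga , gb , gc ; adjacent = ax , bx , cx ; distinct = a≢b , a≢c , b≢c } =
  pigeonhole (neighbours-oneHot n j 2+j≤n _ ga ax) (neighbours-oneHot n j 2+j≤n _ gb bx)
             (neighbours-oneHot n j 2+j≤n _ gc cx) a≢b a≢c b≢c

ThreeLocalNeighbours-onesFrom : ∀ n d → 3 + d ≤ n → ThreeLocalNeighbours (onesFrom n (suc d))
ThreeLocalNeighbours-onesFrom n d 3+d≤n = record
  { generators = Gen-onesFrom n d d<n , Gen-oneHot n d d<n , Gen-onesFrom n (2 + d) 3+d≤n
  ; adjacent = Gen-onesFrom⊕onesFrom n d d<n , Gen-oneHot⊕onesFrom n d d<n ,
               subst Gen (⊕-comm (onesFrom n (suc d)) _) (Gen-onesFrom⊕onesFrom n (suc d) 2+d≤n)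
  ; distinct = (λ e → oneHot≢onesFrom n d 2+d≤n (sym e)) ,
               ≢-by-leadingZeros (leadingZeros-onesFrom n d (<⇒≤ d<n))
                                 (leadingZeros-onesFrom n (2 + d) (<⇒≤ 3+d≤n)) (n≢2+n d) ,
               ≢-by-leadingZeros (leadingZeros-oneHot n d d<n)
                                 (leadingZeros-onesFrom n (2 + d) (<⇒≤ 3+d≤n)) (n≢2+n d)
  }
  where
  2+d≤n : 2 + d ≤ n
  2+d≤n = <⇒≤ 3+d≤n
  d<n : d < n
  d<n = ≤-trans (n≤1+n _) 2+d≤n

-- Write s_d = onesFrom n d and e_d = oneHot n d.  In the subgraph induced on the
-- neighbourhood of 0, s_{d+1} is adjacent to s_d, e_d, s_{d+2} and e_{d+1}, while e_d is
-- adjacent only to s_d and s_{d+1}.  Going down from s_{n-1} = e_{n-1}, the degree tells s_d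
-- (d ≥ 1) apart from e_d, so f fixes both; only e₀ and s₀ = 1ⁿ, which are twins, can be swapped.
module LocalRigidity {k : ℕ} {f : Vertex (2 + k) → Vertex (2 + k)} (emb : IsEmbedding f)
  (fixes-zeros : f (zeros (2 + k)) ≡ zeros (2 + k))
  (fixes-last : f (oneHot (2 + k) (suc k)) ≡ oneHot (2 + k) (suc k)) where

  private
    n : ℕ
    n = 2 + k

  Fixed : ℕ → Set
  Fixed d = f (onesFrom n d) ≡ onesFrom n d × f (oneHot n d) ≡ oneHot n d

  neighbour-choice : ∀ d → suc d < n → Fixed (suc d) → Fixed (2 + d) → ∀ {v} → Gen v →
                     Gen (v ⊕ onesFrom n (suc d)) → v ≢ onesFrom n (2 + d) → v ≢ oneHot n (suc d) →
                     f v ∈ onesFrom n d ∷ oneHot n d ∷ []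
  neighbour-choice d d+1<n (fs₁ , fe₁) (fs₂ , _) {v} g adj v≢s₂ v≢e₁
    with neighbours-onesFrom n d d+1<n (f v) (Gen-preserved emb fixes-zeros g)
           (subst (λ w → Gen (f v ⊕ w)) fs₁ (preserves emb adj))
  ... | here e = here e
  ... | there (here e) = there (here e)
  ... | there (there (here e)) = ⊥-elim (v≢s₂ (injective emb (trans e (sym fs₂))))
  ... | there (there (there (here e))) = ⊥-elim (v≢e₁ (injective emb (trans e (sym fe₁))))

  fixed-step : ∀ d → 3 + d ≤ n → Fixed (2 + d) → Fixed (3 + d) → Fixed (suc d)
  fixed-step d 3+d≤n fixed₂ fixed₃ = fixes-s , fixes-e
    where
    2+d≤n : 2 + d ≤ n
    2+d≤n = <⇒≤ 3+d≤n
    s e : Vertex n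
    s = onesFrom n (suc d)
    e = oneHot n (suc d)
    choice : ∀ {v} → Gen v → Gen (v ⊕ onesFrom n (2 + d)) → leadingZeros v ≡ suc d →
             f v ∈ s ∷ e ∷ []
    choice g adj lead =
      neighbour-choice (suc d) 3+d≤n fixed₂ fixed₃ g adj
        (≢-by-leadingZeros lead (leadingZeros-onesFrom n (3 + d) 3+d≤n) (n≢2+n (suc d)))
        (≢-by-leadingZeros lead (leadingZeros-oneHot n (2 + d) 3+d≤n) (<⇒≢ (n<1+n (suc d))))
    fixes-s : f s ≡ s
    fixes-s with choice (Gen-onesFrom n (suc d) 2+d≤n) (Gen-onesFrom⊕onesFrom n (suc d) 2+d≤n)
                        (leadingZeros-onesFrom n (suc d) (<⇒≤ 2+d≤n))
    ... | here fs≡s = fs≡s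
    ... | there (here fs≡e) =
      ⊥-elim (¬ThreeLocalNeighbours-oneHot n (suc d) 3+d≤n
               (subst ThreeLocalNeighbours fs≡e (ThreeLocalNeighbours-preserved emb fixes-zeros
                                                   (ThreeLocalNeighbours-onesFrom n d 3+d≤n))))
    fixes-e : f e ≡ e
    fixes-e with choice (Gen-oneHot n (suc d) 2+d≤n) (Gen-oneHot⊕onesFrom n (suc d) 2+d≤n)
                        (leadingZeros-oneHot n (suc d) 2+d≤n)
    ... | here fe≡s = ⊥-elim (oneHot≢onesFrom n (suc d) 3+d≤n (injective emb (trans fe≡s (sym fixes-s))))
    ... | there (here fe≡e) = fe≡e

  fixed-window : ∀ i j → i + j ≡ k → Fixed (suc j) × Fixed (2 + j)
  fixed-window zero j j≡k =
    subst (λ j → Fixed (suc j) × Fixed (2 + j)) (sym j≡k) (fixed-last , fixed-beyond)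
    where
    fixed-last : Fixed (suc k)
    fixed-last = subst (λ v → f v ≡ v) (sym (onesFrom-last (suc k))) fixes-last , fixes-last
    fixed-beyond : Fixed n
    fixed-beyond = subst (λ v → f v ≡ v) (sym (onesFrom-beyond n)) fixes-zeros ,
          subst (λ v → f v ≡ v) (sym (oneHot-beyond n)) fixes-zeros
  fixed-window (suc i) j i+j≡k =
    fixed-step j (subst (λ k → 3 + j ≤ 2 + k) i+j≡k (s≤s (s≤s (s≤s (m≤n+m j i))))) fixed₂ fixed₃ , fixed₂
    where
    fixed₂ : Fixed (2 + j)
    fixed₂ = proj₁ (fixed-window i (suc j) (trans (+-suc i j) i+j≡k))
    fixed₃ : Fixed (3 + j)
    fixed₃ = proj₂ (fixed-window i (suc j) (trans (+-suc i j) i+j≡k))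

  fixed-pair : ∀ j → j ≤ k → Fixed (suc j) × Fixed (2 + j)
  fixed-pair j j≤k = fixed-window (k ∸ j) j (m∸n+n≡m j≤k)

  e₀-choice : f (oneHot n 0) ∈ onesFrom n 0 ∷ oneHot n 0 ∷ []
  e₀-choice = neighbour-choice 0 (s≤s (s≤s z≤n)) (proj₁ (fixed-pair 0 z≤n)) (proj₂ (fixed-pair 0 z≤n))
                (Gen-oneHot n 0 (s≤s z≤n)) (Gen-oneHot⊕onesFrom n 0 (s≤s z≤n)) (λ ()) (λ ())

  fixes-Gen : f (oneHot n 0) ≡ oneHot n 0 → ∀ {c} → Gen c → f c ≡ c
  fixes-Gen fixes-e₀ {c} g with Gen-classify c g
  ... | inj₁ (zero , _ , refl) = fixes-e₀
  ... | inj₁ (suc j , s≤s (s≤s j≤k) , refl) = proj₂ (proj₁ (fixed-pair j j≤k))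
  ... | inj₂ (suc d , s≤s (s≤s d<k) , refl) = proj₁ (proj₁ (fixed-pair d (<⇒≤ d<k)))
  ... | inj₂ (zero , _ , refl)
    with neighbour-choice 0 (s≤s (s≤s z≤n)) (proj₁ (fixed-pair 0 z≤n)) (proj₂ (fixed-pair 0 z≤n))
           (Gen-onesFrom n 0 (s≤s z≤n)) (Gen-onesFrom⊕onesFrom n 0 (s≤s z≤n)) (λ ()) (λ ())
  ...   | here fs₀≡s₀ = fs₀≡s₀
  ...   | there (here fs₀≡e₀) =
    ⊥-elim (oneHot≢onesFrom n 0 (s≤s (s≤s z≤n)) (sym (injective emb (trans fs₀≡e₀ (sym fixes-e₀)))))

data Generated {n} : Vertex n → Set where
  zeros-generated : Generated (zeros n)
  ⊕-generated : ∀ {x g} → Generated x → Gen g → Generated (x ⊕ g)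

false∷-generated : ∀ {n} {v : Vertex n} → Generated v → Generated (false ∷ v)
false∷-generated zeros-generated = zeros-generated
false∷-generated (⊕-generated x g) = ⊕-generated (false∷-generated x) g

all-generated : ∀ {n} (v : Vertex n) → Generated v
all-generated [] = zeros-generated
all-generated (false ∷ v) = false∷-generated (all-generated v)
all-generated (true ∷ v) =
  subst Generated (cong (true ∷_) (⊕-identityʳ v))
        (⊕-generated (false∷-generated (all-generated v)) (inj₁ refl))

FixesNeighbourhood : ∀ {n} → (Vertex n → Vertex n) → Set
FixesNeighbourhood {n} f = f (zeros n) ≡ zeros n × (∀ {c} → Gen c → f c ≡ c)

FixesNeighbourhood-cong : ∀ {n} {f h : Vertex n → Vertex n} → (∀ v → f v ≡ h v) →
                          FixesNeighbourhood f → FixesNeighbourhood h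
FixesNeighbourhood-cong {n} f≗h (f0 , fixes) =
  trans (sym (f≗h (zeros n))) f0 , λ g → trans (sym (f≗h _)) (fixes g)

conjugate-zeros : ∀ {n} (f : Vertex n → Vertex n) v → conjugate f (zeros n) v ≡ f v
conjugate-zeros {n} f v = trans (⊕-identityʳ (f (v ⊕ zeros n))) (cong f (⊕-identityʳ v))

conjugate-⊕ : ∀ {n} (f : Vertex n → Vertex n) x y v →
              conjugate (conjugate f x) y v ≡ conjugate f (x ⊕ y) v
conjugate-⊕ f x y v = begin
  (f ((v ⊕ y) ⊕ x) ⊕ x) ⊕ y  ≡⟨ ⊕-assoc _ x y ⟩
  f ((v ⊕ y) ⊕ x) ⊕ (x ⊕ y)  ≡⟨ cong (λ w → f w ⊕ (x ⊕ y)) (⊕-assoc v y x) ⟩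
  f (v ⊕ (y ⊕ x)) ⊕ (x ⊕ y)  ≡⟨ cong (λ w → f (v ⊕ w) ⊕ (x ⊕ y)) (⊕-comm y x) ⟩
  f (v ⊕ (x ⊕ y)) ⊕ (x ⊕ y)  ∎
  where open ≡-Reasoning

¬Gen-ones⊕last : ∀ m → ¬ Gen (ones (3 + m) ⊕ oneHot (3 + m) (2 + m))
¬Gen-ones⊕last m (inj₂ e) =
  oneHot≢zeros (2 + m) (1 + m) (n<1+n _)
    (trans (sym (⊕-cancelˡ (ones (2 + m)) _)) (trans (cong (ones (2 + m) ⊕_) e) (⊕-self (ones (2 + m)))))

module Rigidity (m : ℕ) where

  private
    n : ℕ
    n = 4 + m

  e₀ eₗ : Vertex n
  e₀ = oneHot n 0
  eₗ = oneHot n (3 + m)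

  gen-e₀ : Gen e₀
  gen-e₀ = inj₁ refl

  gen-eₗ : Gen eₗ
  gen-eₗ = Gen-oneHot n (3 + m) (n<1+n _)

  common-neighbours-e₀-eₗ : ∀ w → Gen (w ⊕ e₀) → Gen (w ⊕ eₗ) → w ≡ zeros n ⊎ w ≡ e₀ ⊕ eₗ
  common-neighbours-e₀-eₗ (false ∷ w) (inj₁ e) _ = inj₁ (cong (false ∷_) (⊕≡zeros⇒≡ e))
  common-neighbours-e₀-eₗ (false ∷ w) (inj₂ e) g =
    ⊥-elim (¬Gen-ones⊕last m (subst (λ v → Gen (v ⊕ _)) (trans (sym (⊕-identityʳ w)) e) g))
  common-neighbours-e₀-eₗ (true ∷ w) _ (inj₁ e) =
    inj₂ (cong (true ∷_) (trans (⊕≡zeros⇒≡ e) (sym (⊕-identityˡ _))))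
  common-neighbours-e₀-eₗ (true ∷ w) g (inj₂ e) =
    ⊥-elim (¬Gen-ones⊕last m (subst Gen (⊕≡⇒≡⊕ e) (subst Gen (⊕-identityʳ w) g)))

  fixes-neighbourhood : ∀ {f : Vertex n → Vertex n} → IsEmbedding f → f (zeros n) ≡ zeros n →
                        f e₀ ≡ e₀ → f eₗ ≡ eₗ → FixesNeighbourhood f
  fixes-neighbourhood emb f0 fe₀ feₗ = f0 , LocalRigidity.fixes-Gen emb f0 feₗ fe₀

  fixes-e₀⊕eₗ : ∀ {f : Vertex n → Vertex n} → IsEmbedding f → FixesNeighbourhood f →
                f (e₀ ⊕ eₗ) ≡ e₀ ⊕ eₗ
  fixes-e₀⊕eₗ {f} emb (f0 , fixes) with common-neighbours-e₀-eₗ (f (e₀ ⊕ eₗ))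
    (subst (λ v → Gen (f (e₀ ⊕ eₗ) ⊕ v)) (fixes gen-e₀)
      (preserves emb (subst Gen (sym (trans (cong (_⊕ e₀) (⊕-comm e₀ eₗ)) (⊕-cancelʳ eₗ e₀))) gen-eₗ)))
    (subst (λ v → Gen (f (e₀ ⊕ eₗ) ⊕ v)) (fixes gen-eₗ)
      (preserves emb (subst Gen (sym (⊕-cancelʳ e₀ eₗ)) gen-e₀)))
  ... | inj₁ fw≡0 with () ← injective emb (trans fw≡0 (sym f0))
  ... | inj₂ fw≡w = fw≡w

  -- Conjugating f by the translation by a generator g gives a map fixing 0, e₀ and eₗ,
  -- as f fixes g, g ⊕ e₀ and g ⊕ eₗ; for g ∈ {e₀, eₗ} this is where f (e₀ ⊕ eₗ) ≡ e₀ ⊕ eₗ enters.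
  conjugate-fixes-neighbourhood : ∀ {f : Vertex n → Vertex n} → IsEmbedding f → FixesNeighbourhood f →
                                  ∀ {g} → Gen g → FixesNeighbourhood (conjugate f g)
  conjugate-fixes-neighbourhood {f} emb fixes-nbhd@(f0 , fixes) {g} gen-g =
    fixes-neighbourhood (conjugate-embedding emb g)
      (conjugate-fixes f g (zeros n) (fixed-cong (sym (⊕-identityˡ g)) (fixes gen-g)))
      (conjugate-fixes f g e₀ (fixed-cong (⊕-comm g e₀) (fixes-of-conjugate f e₀ g (proj₂ around-e₀ gen-g))))
      (conjugate-fixes f g eₗ (fixed-cong (⊕-comm g eₗ) (fixes-of-conjugate f eₗ g (proj₂ around-eₗ gen-g))))
    where
    fixed-cong : ∀ {u v} → u ≡ v → f u ≡ u → f v ≡ v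
    fixed-cong = subst (λ w → f w ≡ w)
    fixes-self : ∀ x → f (x ⊕ x) ≡ x ⊕ x
    fixes-self x = fixed-cong (sym (⊕-self x)) f0
    fw : f (e₀ ⊕ eₗ) ≡ e₀ ⊕ eₗ
    fw = fixes-e₀⊕eₗ emb fixes-nbhd
    around-e₀ : FixesNeighbourhood (conjugate f e₀)
    around-e₀ = fixes-neighbourhood (conjugate-embedding emb e₀)
      (conjugate-fixes f e₀ (zeros n) (fixed-cong (sym (⊕-identityˡ e₀)) (fixes gen-e₀)))
      (conjugate-fixes f e₀ e₀ (fixes-self e₀))
      (conjugate-fixes f e₀ eₗ (fixed-cong (⊕-comm e₀ eₗ) fw))
    around-eₗ : FixesNeighbourhood (conjugate f eₗ)
    around-eₗ = fixes-neighbourhood (conjugate-embedding emb eₗ)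
      (conjugate-fixes f eₗ (zeros n) (fixed-cong (sym (⊕-identityˡ eₗ)) (fixes gen-eₗ)))
      (conjugate-fixes f eₗ e₀ fw)
      (conjugate-fixes f eₗ eₗ (fixes-self eₗ))

  conjugate-fixes-neighbourhood-generated : ∀ {f : Vertex n → Vertex n} → IsEmbedding f →
    FixesNeighbourhood f → ∀ {x} → Generated x → FixesNeighbourhood (conjugate f x)
  conjugate-fixes-neighbourhood-generated {f} _ fixes zeros-generated =
    FixesNeighbourhood-cong (λ v → sym (conjugate-zeros f v)) fixes
  conjugate-fixes-neighbourhood-generated {f} emb fixes (⊕-generated {x} {g} gen-x gen-g) =
    FixesNeighbourhood-cong (conjugate-⊕ f x g)
      (conjugate-fixes-neighbourhood (conjugate-embedding emb x)
        (conjugate-fixes-neighbourhood-generated emb fixes gen-x) gen-g)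

  rigid : ∀ {f : Vertex n → Vertex n} → IsEmbedding f → f (zeros n) ≡ zeros n →
          f e₀ ≡ e₀ → f eₗ ≡ eₗ → ∀ v → f v ≡ v
  rigid {f} emb f0 fe₀ feₗ v =
    subst (λ w → f w ≡ w) (⊕-identityˡ v) (fixes-of-conjugate f v (zeros n) conj-fixes-0)
    where
    conj-fixes-0 : conjugate f v (zeros n) ≡ zeros n
    conj-fixes-0 = proj₁ (conjugate-fixes-neighbourhood-generated emb
                            (fixes-neighbourhood emb f0 fe₀ feₗ) (all-generated v))

_≟ᵛ_ : ∀ {n} → DecidableEquality (Vertex n)
_≟ᵛ_ = ≡-dec _≟ᵇ_

indicator : ∀ {n} → List (Vertex n) → Coloring n
indicator xs v = does (any? (v ≟ᵛ_) xs)

indicator-sound : ∀ {n} {xs : List (Vertex n)} {v} → indicator xs v ≡ true → v ∈ xs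
indicator-sound {xs = xs} {v} e with any? (v ≟ᵛ_) xs | e
... | yes v∈xs | _ = v∈xs

indicator-complete : ∀ {n} {xs : List (Vertex n)} {v} → v ∈ xs → indicator xs v ≡ true
indicator-complete {xs = xs} {v} = dec-true (any? (v ≟ᵛ_) xs)

countTrue : ∀ {A : Set} → (A → Bool) → List A → ℕ
countTrue p xs = length (filter (λ x → p x ≟ᵇ true) xs)

countTrue-++ : ∀ {A : Set} (p : A → Bool) xs ys →
               countTrue p (xs ++ ys) ≡ countTrue p xs + countTrue p ys
countTrue-++ p xs ys =
  trans (cong length (filter-++ (λ x → p x ≟ᵇ true) xs ys)) (length-++ (filter (λ x → p x ≟ᵇ true) xs))

countTrue-map : ∀ {A B : Set} (p : B → Bool) (g : A → B) xs →
                countTrue p (map g xs) ≡ countTrue (p ∘ g) xs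
countTrue-map p g [] = refl
countTrue-map p g (x ∷ xs) with p (g x)
... | true = cong suc (countTrue-map p g xs)
... | false = countTrue-map p g xs

countTrue-false : ∀ {A : Set} (p : A → Bool) xs → (∀ x → p x ≡ false) → countTrue p xs ≡ 0
countTrue-false p [] _ = refl
countTrue-false p (x ∷ xs) p≡false rewrite p≡false x = countTrue-false p xs p≡false

countTrue-∨ : ∀ {A : Set} (p q : A → Bool) xs → (∀ x → p x ∧ q x ≡ false) →
              countTrue (λ x → p x ∨ q x) xs ≡ countTrue p xs + countTrue q xs
countTrue-∨ p q [] _ = refl
countTrue-∨ p q (x ∷ xs) disjoint with p x | q x | disjoint x
... | true | false | _ = cong suc (countTrue-∨ p q xs disjoint)
... | false | true | _ = trans (cong suc (countTrue-∨ p q xs disjoint)) (sym (+-suc _ _))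
... | false | false | _ = countTrue-∨ p q xs disjoint

countTrue-singleton : ∀ n (a : Vertex n) → countTrue (λ v → does (v ≟ᵛ a)) (allVertices n) ≡ 1
countTrue-singleton zero [] = refl
countTrue-singleton (suc n) (b ∷ a) = begin
  countTrue (λ v → does (v ≟ᵛ (b ∷ a))) (map (true ∷_) vs ++ map (false ∷_) vs)
    ≡⟨ countTrue-++ _ (map (true ∷_) vs) _ ⟩
  countTrue (λ v → does (v ≟ᵛ (b ∷ a))) (map (true ∷_) vs) +
  countTrue (λ v → does (v ≟ᵛ (b ∷ a))) (map (false ∷_) vs)
    ≡⟨ cong₂ _+_ (countTrue-map _ (true ∷_) vs) (countTrue-map _ (false ∷_) vs) ⟩
  countTrue (λ v → does (true ≟ᵇ b) ∧ does (v ≟ᵛ a)) vs +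
  countTrue (λ v → does (false ≟ᵇ b) ∧ does (v ≟ᵛ a)) vs
    ≡⟨ halves b ⟩
  1 ∎
  where
  open ≡-Reasoning
  vs : List (Vertex n)
  vs = allVertices n
  halves : ∀ b → countTrue (λ v → does (true ≟ᵇ b) ∧ does (v ≟ᵛ a)) vs +
                 countTrue (λ v → does (false ≟ᵇ b) ∧ does (v ≟ᵛ a)) vs ≡ 1
  halves true = cong₂ _+_ (countTrue-singleton n a) (countTrue-false _ vs (λ _ → refl))
  halves false = cong₂ _+_ (countTrue-false _ vs (λ _ → refl)) (countTrue-singleton n a)

classSize-indicator : ∀ {n} {xs : List (Vertex n)} → Unique xs →
                      classSize n (indicator xs) true ≡ length xs
classSize-indicator {n} {[]} _ = countTrue-false _ (allVertices n) (λ _ → refl)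
classSize-indicator {n} {x ∷ xs} (x∉xs ∷ unique) = begin
  countTrue (λ v → does (v ≟ᵛ x) ∨ indicator xs v) (allVertices n)
    ≡⟨ countTrue-∨ _ _ (allVertices n) disjoint ⟩
  countTrue (λ v → does (v ≟ᵛ x)) (allVertices n) + classSize n (indicator xs) true
    ≡⟨ cong₂ _+_ (countTrue-singleton n x) (classSize-indicator unique) ⟩
  suc (length xs) ∎
  where
  open ≡-Reasoning
  disjoint : ∀ v → does (v ≟ᵛ x) ∧ indicator xs v ≡ false
  disjoint v with v ≟ᵛ x
  ... | yes refl = dec-false (any? (v ≟ᵛ_) xs) (All¬⇒¬Any x∉xs)
  ... | no _ = refl

-- An automorphism preserving the class {0, eₗ, q = e₀ ⊕ e₂} fixes q, the vertex isolated in
-- it, and cannot swap 0 and eₗ: followed by the translation by eₗ such a swap would fix 0 and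
-- eₗ, hence e₂, while moving the neighbour q of e₂ to q ⊕ eₗ, which is not a neighbour of e₂.
-- As q is adjacent to e₀ but not to 1ⁿ, it also rules out the exchange of e₀ and 1ⁿ.
module Colouring (m : ℕ) where

  open Rigidity m

  private
    n : ℕ
    n = 4 + m

  q e₂ : Vertex n
  q = true ∷ false ∷ true ∷ zeros (suc m)
  e₂ = oneHot n 2

  class : List (Vertex n)
  class = zeros n ∷ eₗ ∷ q ∷ []

  colouring : Coloring n
  colouring = indicator class

  eₗ≢zeros : eₗ ≢ zeros n
  eₗ≢zeros = oneHot≢zeros n (3 + m) (n<1+n _)

  class-unique : Unique class
  class-unique = ((eₗ≢zeros ∘ sym) ∷ (λ ()) ∷ []) ∷ ((λ ()) ∷ []) ∷ [] ∷ []

  q-isolated : ∀ {u} → u ∈ class → ¬ Gen (q ⊕ u)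
  q-isolated (here refl) = λ { (inj₁ ()) ; (inj₂ ()) }
  q-isolated (there (here refl)) = λ { (inj₁ ()) ; (inj₂ ()) }
  q-isolated (there (there (here refl))) = ¬Gen-zeros (suc m) ∘ subst Gen (⊕-self (zeros (suc m)))

  Gen-q⊕e₀ : Gen (q ⊕ e₀)
  Gen-q⊕e₀ = inj₁ (⊕-self (zeros (suc m)))

  ¬Gen-q⊕ones : ¬ Gen (q ⊕ ones n)
  ¬Gen-q⊕ones (inj₁ ())
  ¬Gen-q⊕ones (inj₂ ())

  Gen-q⊕e₂ : Gen (q ⊕ e₂)
  Gen-q⊕e₂ = inj₁ (cong (λ v → false ∷ false ∷ v) (⊕-self (zeros (suc m))))

  ¬Gen-q⊕eₗ⊕e₂ : ¬ Gen ((q ⊕ eₗ) ⊕ e₂)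
  ¬Gen-q⊕eₗ⊕e₂ (inj₁ e) =
    oneHot≢zeros (suc m) m (n<1+n m)
      (trans (sym (trans (⊕-identityʳ _) (⊕-identityˡ _))) (cong (tail ∘ tail) e))

  no-swap : ∀ {f : Vertex n → Vertex n} → IsEmbedding f →
            f (zeros n) ≡ eₗ → f eₗ ≡ zeros n → f q ≡ q → ⊥
  no-swap {f} emb f0≡eₗ feₗ≡0 fq≡q =
    ¬Gen-q⊕eₗ⊕e₂ (subst₂ (λ a b → Gen (a ⊕ b)) (cong (_⊕ eₗ) fq≡q) he₂≡e₂ (preserves h-emb Gen-q⊕e₂))
    where
    h : Vertex n → Vertex n
    h v = f v ⊕ eₗ
    h-emb : IsEmbedding h
    h-emb = ∘-embedding (translation-embedding eₗ) emb
    he₂≡e₂ : h e₂ ≡ e₂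
    he₂≡e₂ = proj₂ (proj₁ (LocalRigidity.fixed-pair h-emb
                      (trans (cong (_⊕ eₗ) f0≡eₗ) (⊕-self eₗ))
                      (trans (cong (_⊕ eₗ) feₗ≡0) (⊕-identityˡ eₗ)) 1 (s≤s z≤n)))

  module _ {f : Vertex n → Vertex n} (emb : IsEmbedding f)
           (into : ∀ {v} → v ∈ class → f v ∈ class)
           (onto : ∀ {v} → v ∈ class → Σ (Vertex n) λ u → u ∈ class × f u ≡ v) where

    image-q-isolated : ∀ {w} → w ∈ class → ¬ Gen (f q ⊕ w)
    image-q-isolated w∈class g with u , u∈class , fu≡w ← onto w∈class =
      q-isolated u∈class (reflects emb (subst (λ b → Gen (f q ⊕ b)) (sym fu≡w) g))

    fixes-q : f q ≡ q
    fixes-q with into (there (there (here refl)))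
    ... | here fq≡0 =
      ⊥-elim (image-q-isolated (there (here refl)) (subst (λ a → Gen (a ⊕ eₗ)) (sym fq≡0)
                                                    (subst Gen (sym (⊕-identityˡ eₗ)) gen-eₗ)))
    ... | there (here fq≡eₗ) =
      ⊥-elim (image-q-isolated (here refl) (subst (λ a → Gen (a ⊕ zeros n)) (sym fq≡eₗ)
                                             (subst Gen (sym (⊕-identityʳ eₗ)) gen-eₗ)))
    ... | there (there (here fq≡q)) = fq≡q

    fixes-zeros-eₗ : f (zeros n) ≡ zeros n × f eₗ ≡ eₗ
    fixes-zeros-eₗ with into (here refl) | into (there (here refl))
    ... | here f0≡0 | here feₗ≡0 = ⊥-elim (eₗ≢zeros (injective emb (trans feₗ≡0 (sym f0≡0))))
    ... | here f0≡0 | there (here feₗ≡eₗ) = f0≡0 , feₗ≡eₗ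
    ... | there (here f0≡eₗ) | here feₗ≡0 = ⊥-elim (no-swap emb f0≡eₗ feₗ≡0 fixes-q)
    ... | there (here f0≡eₗ) | there (here feₗ≡eₗ) =
      ⊥-elim (eₗ≢zeros (injective emb (trans feₗ≡eₗ (sym f0≡eₗ))))
    ... | _ | there (there (here feₗ≡q)) with () ← injective emb (trans feₗ≡q (sym fixes-q))
    ... | there (there (here f0≡q)) | _ with () ← injective emb (trans f0≡q (sym fixes-q))

    fixes-e₀ : f e₀ ≡ e₀
    fixes-e₀ with LocalRigidity.e₀-choice emb (proj₁ fixes-zeros-eₗ) (proj₂ fixes-zeros-eₗ)
    ... | here fe₀≡ones =
      ⊥-elim (¬Gen-q⊕ones (subst₂ (λ a b → Gen (a ⊕ b)) fixes-q fe₀≡ones (preserves emb Gen-q⊕e₀)))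
    ... | there (here fe₀≡e₀) = fe₀≡e₀

  distinguishing : Distinguishing n colouring
  distinguishing σ preserves-colour =
    rigid emb (proj₁ fixes-zeros-eₗ′) (fixes-e₀ emb into onto) (proj₂ fixes-zeros-eₗ′)
    where
    open Inverse (Automorphism.perm σ) using (to; from; strictlyInverseˡ)
    emb : IsEmbedding to
    emb = automorphism⇒embedding σ
    into : ∀ {v} → v ∈ class → to v ∈ class
    into {v} v∈class = indicator-sound (trans (preserves-colour v) (indicator-complete v∈class))
    onto : ∀ {v} → v ∈ class → Σ (Vertex n) λ u → u ∈ class × to u ≡ v
    onto {v} v∈class =
      from v ,
      indicator-sound (trans (sym (preserves-colour (from v)))
                             (trans (cong colouring (strictlyInverseˡ v)) (indicator-complete v∈class))) ,
      strictlyInverseˡ v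
    fixes-zeros-eₗ′ : to (zeros n) ≡ zeros n × to eₗ ≡ eₗ
    fixes-zeros-eₗ′ = fixes-zeros-eₗ emb into onto

  classSize-colouring : classSize n colouring true ≡ 3
  classSize-colouring = classSize-indicator class-unique

involutive-embedding : ∀ {n} {h : Vertex n → Vertex n} → (∀ v → h (h v) ≡ v) →
                       (∀ {u v} → Gen (u ⊕ v) → Gen (h u ⊕ h v)) → IsEmbedding h
involutive-embedding {h = h} involutive pres = record
  { injective = λ {u} {v} e → trans (sym (involutive u)) (trans (cong h e) (involutive v))
  ; preserves = pres
  ; reflects = λ {u} {v} g → subst₂ (λ a b → Gen (a ⊕ b)) (involutive u) (involutive v) (pres g)
  }

involution⇒automorphism : ∀ {m} {h : Vertex (suc m) → Vertex (suc m)} →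
                          IsEmbedding h → (∀ v → h (h v) ≡ v) → Automorphism (suc m)
involution⇒automorphism {h = h} emb involutive = record
  { perm = mk↔ₛ′ h h involutive involutive
  ; preservesAdj = λ u v → (λ adj → Gen⇒Adj (h u) (h v) (preserves emb (Adj⇒Gen u v adj))) ,
                           (λ adj → Gen⇒Adj u v (reflects emb (Adj⇒Gen (h u) (h v) adj)))
  }

conjugate-involutive : ∀ {n} {h : Vertex n → Vertex n} → (∀ v → h (h v) ≡ v) →
                       ∀ x v → conjugate h x (conjugate h x v) ≡ v
conjugate-involutive {h = h} involutive x v = begin
  h ((h (v ⊕ x) ⊕ x) ⊕ x) ⊕ x  ≡⟨ cong (λ w → h w ⊕ x) (⊕-cancelʳ (h (v ⊕ x)) x) ⟩
  h (h (v ⊕ x)) ⊕ x            ≡⟨ cong (_⊕ x) (involutive (v ⊕ x)) ⟩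
  (v ⊕ x) ⊕ x                  ≡⟨ ⊕-cancelʳ v x ⟩
  v                            ∎
  where open ≡-Reasoning

flipTail : ∀ {m} → Vertex (suc m) → Vertex (suc m)
flipTail (false ∷ v) = false ∷ v
flipTail (true ∷ v) = true ∷ (v ⊕ ones _)

flipTail-involutive : ∀ {m} (v : Vertex (suc m)) → flipTail (flipTail v) ≡ v
flipTail-involutive (false ∷ v) = refl
flipTail-involutive (true ∷ v) = cong (true ∷_) (⊕-cancelʳ v (ones _))

flipTail-⊕ : ∀ {m} (u v : Vertex (suc m)) → flipTail (u ⊕ v) ≡ flipTail u ⊕ flipTail v
flipTail-⊕ (false ∷ u) (false ∷ v) = refl
flipTail-⊕ (false ∷ u) (true ∷ v) = cong (true ∷_) (⊕-assoc u v (ones _))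
flipTail-⊕ (true ∷ u) (false ∷ v) =
  cong (true ∷_) (trans (⊕-assoc u v (ones _))
                        (trans (cong (u ⊕_) (⊕-comm v (ones _))) (sym (⊕-assoc u (ones _) v))))
flipTail-⊕ (true ∷ u) (true ∷ v) = cong (false ∷_) (sym (⊕-shiftʳ u v (ones _)))

Gen-flipTail : ∀ {m} {v : Vertex (suc m)} → Gen v → Gen (flipTail v)
Gen-flipTail {v = false ∷ v} g = g
Gen-flipTail {m} {true ∷ v} (inj₁ refl) = inj₂ (⊕-identityˡ (ones m))
Gen-flipTail {m} {true ∷ v} (inj₂ refl) = inj₁ (⊕-self (ones m))

flipTail-embedding : ∀ {m} → IsEmbedding (flipTail {m})
flipTail-embedding = involutive-embedding flipTail-involutive
  (λ {u} {v} g → subst Gen (flipTail-⊕ u v) (Gen-flipTail {v = u ⊕ v} g))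

allVertices-complete : ∀ n (v : Vertex n) → v ∈ allVertices n
allVertices-complete zero [] = here refl
allVertices-complete (suc n) (true ∷ v) = ∈-++⁺ˡ (∈-map⁺ (true ∷_) (allVertices-complete n v))
allVertices-complete (suc n) (false ∷ v) =
  ∈-++⁺ʳ (map (true ∷_) (allVertices n)) (∈-map⁺ (false ∷_) (allVertices-complete n v))

≢-same : ∀ {x y b : Bool} → x ≢ b → y ≢ b → x ≡ y
≢-same x≢b y≢b = trans (¬-not x≢b) (sym (¬-not y≢b))

-- An empty colour class is preserved by a translation, a class {a} by the conjugate of
-- flipTail fixing a, and a class {a, a′} by the translation exchanging a and a′.
module LowerBound {m} (c : Coloring (2 + m)) (distinguishing : Distinguishing (2 + m) c) (b : Bool) where

  private
    n : ℕ
    n = 2 + m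

  fixes-class-preserving-involution : ∀ {h : Vertex n → Vertex n} → IsEmbedding h → (∀ v → h (h v) ≡ v) →
                                      (∀ {v} → c v ≡ b → c (h v) ≡ b) → ∀ v → h v ≡ v
  fixes-class-preserving-involution {h} emb involutive class-closed =
    distinguishing (involution⇒automorphism emb involutive) preserves-c
    where
    preserves-c : ∀ v → c (h v) ≡ c v
    preserves-c v with c v ≟ᵇ b
    ... | yes cv≡b = trans (class-closed cv≡b) (sym cv≡b)
    ... | no cv≢b = ≢-same (λ chv≡b → cv≢b (subst (λ w → c w ≡ b) (involutive v) (class-closed chv≡b))) cv≢b

  empty-class : ¬ (∀ v → c v ≢ b)
  empty-class c≢b with () ← fixes-class-preserving-involution (translation-embedding (oneHot n 0))
    (λ v → ⊕-cancelʳ v (oneHot n 0)) (λ {v} cv≡b → ⊥-elim (c≢b v cv≡b)) (zeros n)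

  singleton-class : ∀ a → ¬ (∀ {v} → c v ≡ b → v ≡ a)
  singleton-class a only-a =
    flipTail-moves-e₀ (subst (λ w → flipTail w ≡ w) (⊕-cancelʳ e₀ a)
                             (fixes-of-conjugate flipTail a (e₀ ⊕ a) (h-fixes (e₀ ⊕ a))))
    where
    e₀ : Vertex n
    e₀ = oneHot n 0
    h : Vertex n → Vertex n
    h = conjugate flipTail a
    h-fixes-a : h a ≡ a
    h-fixes-a = trans (cong (λ w → flipTail w ⊕ a) (⊕-self a)) (⊕-identityˡ a)
    class-closed : ∀ {v} → c v ≡ b → c (h v) ≡ b
    class-closed cv≡b with refl ← only-a cv≡b = trans (cong c h-fixes-a) cv≡b
    h-fixes : ∀ v → h v ≡ v
    h-fixes = fixes-class-preserving-involution (conjugate-embedding flipTail-embedding a)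
                (conjugate-involutive {h = flipTail} flipTail-involutive a) class-closed
    flipTail-moves-e₀ : flipTail e₀ ≢ e₀
    flipTail-moves-e₀ ()

  pair-class : ∀ {a a′} → a ≢ a′ → c a ≡ b → c a′ ≡ b → ¬ (∀ {v} → c v ≡ b → v ≡ a ⊎ v ≡ a′)
  pair-class {a} {a′} a≢a′ ca≡b ca′≡b only-a-a′ =
    a≢a′ (sym (trans (sym (h-swaps-a)) (fixes-class-preserving-involution (translation-embedding d)
                                                       (λ v → ⊕-cancelʳ v d) class-closed a)))
    where
    d : Vertex n
    d = a ⊕ a′
    h-swaps-a : a ⊕ d ≡ a′
    h-swaps-a = ⊕-cancelˡ a a′
    h-swaps-a′ : a′ ⊕ d ≡ a
    h-swaps-a′ = trans (cong (a′ ⊕_) (⊕-comm a a′)) (⊕-cancelˡ a′ a)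
    class-closed : ∀ {v} → c v ≡ b → c (v ⊕ d) ≡ b
    class-closed cv≡b with only-a-a′ cv≡b
    ... | inj₁ refl = subst (λ w → c w ≡ b) (sym h-swaps-a) ca′≡b
    ... | inj₂ refl = subst (λ w → c w ≡ b) (sym h-swaps-a′) ca≡b

  class : List (Vertex n)
  class = filter (λ v → c v ≟ᵇ b) (allVertices n)

  ∈-class : ∀ {v} → c v ≡ b → v ∈ class
  ∈-class {v} = ∈-filter⁺ (λ v → c v ≟ᵇ b) (allVertices-complete n v)

  class-∈ : ∀ {v} → v ∈ class → c v ≡ b
  class-∈ v∈class = proj₂ (∈-filter⁻ (λ v → c v ≟ᵇ b) {xs = allVertices n} v∈class)

  members-of-pair : ∀ {a a′} → class ≡ a ∷ a′ ∷ [] → ∀ {v} → c v ≡ b → v ≡ a ⊎ v ≡ a′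
  members-of-pair class≡[a,a′] cv≡b with subst (_ ∈_) class≡[a,a′] (∈-class cv≡b)
  ... | here v≡a = inj₁ v≡a
  ... | there (here v≡a′) = inj₂ v≡a′

  3≤length : ∀ xs → class ≡ xs → 3 ≤ length xs
  3≤length [] class≡[] =
    ⊥-elim (empty-class λ v cv≡b → case subst (v ∈_) class≡[] (∈-class cv≡b) of λ ())
  3≤length (a ∷ []) class≡[a] =
    ⊥-elim (singleton-class a λ cv≡b → only (subst (_ ∈_) class≡[a] (∈-class cv≡b)))
    where
    only : ∀ {v} → v ∈ a ∷ [] → v ≡ a
    only (here v≡a) = v≡a
  3≤length (a ∷ a′ ∷ []) class≡[a,a′] with a ≟ᵛ a′
  ... | yes refl = ⊥-elim (singleton-class a ([ id , id ]′ ∘ members-of-pair class≡[a,a′]))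
  ... | no a≢a′ = ⊥-elim (pair-class a≢a′ (class-∈ (subst (a ∈_) (sym class≡[a,a′]) (here refl)))
                                         (class-∈ (subst (a′ ∈_) (sym class≡[a,a′]) (there (here refl))))
                                         (members-of-pair class≡[a,a′]))
  3≤length (_ ∷ _ ∷ _ ∷ _) _ = s≤s (s≤s (s≤s z≤n))

  3≤classSize : 3 ≤ classSize n c b
  3≤classSize = 3≤length class refl

theorem7p6 : (n : ℕ) → 4 ≤ n → CostIs n 3
theorem7p6 _ (s≤s (s≤s (s≤s (s≤s {n = m} _)))) =
  (colouring , distinguishing , true , classSize-colouring) ,
  (λ c dist b → LowerBound.3≤classSize c dist b)
  where open Colouring m
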